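{- For every integer $k\ge 2$, the coefficient $C_{k,k-1}$ of $\rho^{k-1}$ in the generalized cosecant number $c_{\rho,k}$ is $$C_{k,k-1}=\frac{1}{5\cdot (3!)^k\,(k-2)!}.$$
   Context: For a complex parameter $\rho$, the generalized cosecant numbers $c_{\rho,k}$ ($k=0,1,2,\dots$) are the coefficients of the power series expansion about $z=0$ of $(z/\sin z)^{\rho}$ (principal branch, equal to $1$ at $z=0$): $(z/\sin z)^{\rho}=\sum_{k\ge 0}c_{\rho,k}z^{2k}$. Equivalently, $c_{\rho,k}=(-1)^k\sum (-1)^{N}(\rho)_{N}\prod_{i=1}^k\big(\tfrac{1}{(2i+1)!}\big)^{\lambda_i}\tfrac{1}{\lambda_i!}$, the sum running over all tuples of nonnegative integers $(\lambda_1,\dots,\lambda_k)$ with $\sum_i i\lambda_i=k$, where $N=\sum_i\lambda_i$ and $(\rho)_N=\Gamma(\rho+N)/\Gamma(\rho)$. For $k\ge1$, $c_{\rho,k}$ is a polynomial in $\rho$ of degree $k$ with zero constant term; write $c_{\rho,k}=\sum_{i=1}^k C_{k,i}\rho^i$. -}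

module Defs where

open import Data.Nat as ℕ using (ℕ; zero; suc; _!; NonZero)
open import Data.Nat.Properties using (_!≢0; m^n≢0; m*n≢0)
open import Data.Integer using (+_)
open import Data.Rational using (ℚ; 0ℚ; 1ℚ; _+_; _*_; -_; _/_)
open import Data.List using (List; []; _∷_; map; foldr; filter; concatMap; upTo; length)
open import Data.Nat.ListAction using (sum)
open import Relation.Nullary.Decidable using (Dec)

-- Polynomials in ρ with rational coefficients, as coefficient lists
-- (constant term first).

Poly : Set
Poly = List ℚ

addP : Poly → Poly → Poly
addP []       q        = q
addP p        []       = p
addP (a ∷ p)  (b ∷ q)  = (a + b) ∷ addP p q

scaleP : ℚ → Poly → Poly
scaleP c = map (c *_)

mulLin : ℚ → Poly → Poly
mulLin c p = addP (0ℚ ∷ p) (scaleP c p)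

coeff : Poly → ℕ → ℚ
coeff []       _       = 0ℚ
coeff (a ∷ p)  zero    = a
coeff (a ∷ p)  (suc i) = coeff p i

-- Pochhammer symbol (ρ)_N = ρ(ρ+1)⋯(ρ+N-1) as a polynomial in ρ
poch : ℕ → Poly
poch zero    = 1ℚ ∷ []
poch (suc n) = mulLin (+ n / 1) (poch n)

allTuples : ℕ → ℕ → List (List ℕ)
allTuples zero    b = [] ∷ []
allTuples (suc n) b = concatMap (λ x → map (x ∷_) (allTuples n b)) (upTo (suc b))

-- Σ i·λᵢ, with the head of the list being λ₁
weightFrom : ℕ → List ℕ → ℕ
weightFrom i []       = 0
weightFrom i (l ∷ ls) = i ℕ.* l ℕ.+ weightFrom (suc i) ls

weight : List ℕ → ℕ
weight = weightFrom 1

total : List ℕ → ℕ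
total = sum

-- tuples with Σ i λᵢ = k; each λᵢ ≤ k automatically, so enumerating
-- {0,…,k}^k and filtering gives exactly all such tuples
partitionTuples : ℕ → List (List ℕ)
partitionTuples k = filter (λ l → weight l ℕ.≟ k) (allTuples k k)

factor : ℕ → ℕ → ℚ
factor i l = (+ 1 / (((2 ℕ.* i ℕ.+ 1) !) ℕ.^ l ℕ.* l !))
  {{m*n≢0 _ _ {{m^n≢0 _ l {{(2 ℕ.* i ℕ.+ 1) !≢0}}}} {{l !≢0}}}}

prodFactorFrom : ℕ → List ℕ → ℚ
prodFactorFrom i []       = 1ℚ
prodFactorFrom i (l ∷ ls) = factor i l * prodFactorFrom (suc i) ls

prodFactor : List ℕ → ℚ
prodFactor = prodFactorFrom 1

sgn : ℕ → ℚ
sgn zero    = 1ℚ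
sgn (suc n) = - sgn n

-- Generalized cosecant number c_{ρ,k} as a polynomial in ρ:
-- c_{ρ,k} = (-1)^k Σ_{λ} (-1)^N (ρ)_N ∏ᵢ (1/(2i+1)!)^{λᵢ} / λᵢ!

cosecPoly : ℕ → Poly
cosecPoly k =
  foldr addP []
    (map (λ l → scaleP (sgn (k ℕ.+ total l) * prodFactor l) (poch (total l)))
         (partitionTuples k))

C : ℕ → ℕ → ℚ
C k i = coeff (cosecPoly k) i

denom : ℕ → ℕ
denom k = 5 ℕ.* (3 !) ℕ.^ k ℕ.* (k ℕ.∸ 2) !

target : ℕ → ℚ
target k = (+ 1 / denom k)
  {{m*n≢0 _ _ {{m*n≢0 5 _ {{_}} {{m^n≢0 (3 !) k {{3 !≢0}}}}}} {{(k ℕ.∸ 2) !≢0}}}}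

{-# OPTIONS --safe #-}
-- Since (ρ)_N has degree N, only tuples with N = Σ λᵢ ≥ k − 1 contribute to the coefficient of
-- ρ^(k−1), and together with Σ i λᵢ = k this leaves λ = (k, 0, …, 0) and λ = (k − 2, 1, 0, …, 0).
-- The first contributes 1/((3!)^k k!) times the subleading coefficient k(k − 1)/2 of (ρ)_k, the
-- second −1/((3!)^(k−2) (k − 2)! 5!). With D = (3!)^(k−2) (k − 2)! these are 1/(72 D) and
-- −1/(120 D), and 1/72 − 1/120 = 1/180 gives 1/(180 D) = 1/(5 (3!)^k (k − 2)!).
module Submission where

open import Defs
open import Data.Nat using (ℕ; _≤_; _∸_)
open import Relation.Binary.PropositionalEquality using (_≡_)

open import Algebra.Bundles using (CommutativeMonoid)
open import Data.Bool using (Bool; true; false; if_then_else_)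
open import Data.Empty using (⊥-elim)
import Data.Integer as ℤ
import Data.Integer.Properties as ℤP
open import Data.List using (List; []; _∷_; _++_; map; foldr; concatMap; filter; applyUpTo; upTo; replicate; length)
import Data.List.Properties as ListP
open import Data.List.Relation.Unary.All using (All; []; _∷_)
open import Data.List.Relation.Unary.All.Properties using (applyUpTo⁺₂; replicate⁺)
open import Data.Nat as ℕ using (zero; suc; NonZero; _<_; _!; z≤n; s≤s)
import Data.Nat.Properties as ℕP
open import Data.Nat.ListAction using (sum)
open import Data.Nat.Tactic.RingSolver using (solve-∀)
open import Data.Product using (_×_; _,_)
open import Data.Rational using (ℚ; 0ℚ; 1ℚ; _+_; _*_; -_; _/_; toℚᵘ)
import Data.Rational.Properties as ℚP
open import Data.Rational.Unnormalised as ℚᵘ using (mkℚᵘ; *≡*)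
import Data.Rational.Unnormalised.Properties as ℚᵘP
open import Data.Sum using (_⊎_; inj₁; inj₂; [_,_])
open import Relation.Binary.PropositionalEquality
  using (refl; sym; trans; cong; cong₂; _≢_; module ≡-Reasoning)
open import Relation.Nullary using (does; yes; no)
open import Relation.Nullary.Decidable using (dec-true; dec-false)
open import Relation.Binary.Definitions using (DecidableEquality)
open import Relation.Unary using (Decidable)
open import Algebra.Properties.Group ℚP.+-0-group using (⁻¹-involutive; //-rightDividesʳ)
open import Algebra.Properties.CommutativeSemigroup
  (CommutativeMonoid.commutativeSemigroup ℚP.+-0-commutativeMonoid) using (interchange)

private
  variable
    A B : Set

-- Fractions of natural numbers

/-cross : ∀ a b c d .{{_ : NonZero b}} .{{_ : NonZero d}} →
          a ℕ.* d ≡ c ℕ.* b → ℤ.+ a / b ≡ ℤ.+ c / d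
/-cross a (suc b) c (suc d) ad≡cb = ℚP.fromℚᵘ-cong {mkℚᵘ (ℤ.+ a) b} {mkℚᵘ (ℤ.+ c) d}
  (*≡* (trans (sym (ℤP.pos-* a (suc d))) (trans (cong ℤ.+_ ad≡cb) (ℤP.pos-* c (suc b)))))

toℚᵘ-/ : ∀ a b → toℚᵘ (ℤ.+ a / suc b) ℚᵘ.≃ mkℚᵘ (ℤ.+ a) b
toℚᵘ-/ a b = ℚP.toℚᵘ-fromℚᵘ (mkℚᵘ (ℤ.+ a) b)

/-*-/ : ∀ a b c d .{{_ : NonZero b}} .{{_ : NonZero d}} →
        (ℤ.+ a / b) * (ℤ.+ c / d) ≡ (ℤ.+ (a ℕ.* c) / (b ℕ.* d)) {{ℕP.m*n≢0 b d}}
/-*-/ a (suc b) c (suc d) = ℚP.toℚᵘ-injective (begin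
  toℚᵘ (ℤ.+ a / suc b * (ℤ.+ c / suc d))              ≈⟨ ℚP.toℚᵘ-homo-* (ℤ.+ a / suc b) (ℤ.+ c / suc d) ⟩
  toℚᵘ (ℤ.+ a / suc b) ℚᵘ.* toℚᵘ (ℤ.+ c / suc d)      ≈⟨ ℚᵘP.*-cong (toℚᵘ-/ a b) (toℚᵘ-/ c d) ⟩
  mkℚᵘ (ℤ.+ a) b ℚᵘ.* mkℚᵘ (ℤ.+ c) d                 ≈⟨ *≡* (cong (ℤ._* ℤ.+ suc bd) (sym (ℤP.pos-* a c))) ⟩
  mkℚᵘ (ℤ.+ (a ℕ.* c)) bd                             ≈⟨ toℚᵘ-/ (a ℕ.* c) bd ⟨
  toℚᵘ (ℤ.+ (a ℕ.* c) / (suc b ℕ.* suc d))            ∎)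
  where
  open ℚᵘP.≃-Reasoning
  bd : ℕ
  bd = d ℕ.+ b ℕ.* suc d

/-+-/ : ∀ a b c d .{{_ : NonZero b}} .{{_ : NonZero d}} →
        (ℤ.+ a / b) + (ℤ.+ c / d) ≡ (ℤ.+ (a ℕ.* d ℕ.+ c ℕ.* b) / (b ℕ.* d)) {{ℕP.m*n≢0 b d}}
/-+-/ a (suc b) c (suc d) = ℚP.toℚᵘ-injective (begin
  toℚᵘ (ℤ.+ a / suc b + ℤ.+ c / suc d)                ≈⟨ ℚP.toℚᵘ-homo-+ (ℤ.+ a / suc b) (ℤ.+ c / suc d) ⟩
  toℚᵘ (ℤ.+ a / suc b) ℚᵘ.+ toℚᵘ (ℤ.+ c / suc d)      ≈⟨ ℚᵘP.+-cong (toℚᵘ-/ a b) (toℚᵘ-/ c d) ⟩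
  mkℚᵘ (ℤ.+ a) b ℚᵘ.+ mkℚᵘ (ℤ.+ c) d                 ≈⟨ *≡* (cong (ℤ._* ℤ.+ suc bd) (sym numerator)) ⟩
  mkℚᵘ (ℤ.+ n) bd                                     ≈⟨ toℚᵘ-/ n bd ⟨
  toℚᵘ (ℤ.+ n / (suc b ℕ.* suc d))                    ∎)
  where
  open ℚᵘP.≃-Reasoning
  bd n : ℕ
  bd = d ℕ.+ b ℕ.* suc d
  n  = a ℕ.* suc d ℕ.+ c ℕ.* suc b
  numerator : ℤ.+ n ≡ ℤ.+ a ℤ.* ℤ.+ suc d ℤ.+ ℤ.+ c ℤ.* ℤ.+ suc b
  numerator = trans (ℤP.pos-+ (a ℕ.* suc d) (c ℕ.* suc b))
                    (cong₂ ℤ._+_ (ℤP.pos-* a (suc d)) (ℤP.pos-* c (suc b)))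

-- Finite sums of rationals

sumMap : (A → ℚ) → List A → ℚ
sumMap g []       = 0ℚ
sumMap g (x ∷ xs) = g x + sumMap g xs

sumMap-cong : {g h : A → ℚ} → (∀ x → g x ≡ h x) → ∀ xs → sumMap g xs ≡ sumMap h xs
sumMap-cong g≗h []       = refl
sumMap-cong g≗h (x ∷ xs) = cong₂ _+_ (g≗h x) (sumMap-cong g≗h xs)

sumMap-zero : {g : A → ℚ} {xs : List A} → All (λ x → g x ≡ 0ℚ) xs → sumMap g xs ≡ 0ℚ
sumMap-zero []             = refl
sumMap-zero (gx≡0 ∷ gxs≡0) = trans (cong₂ _+_ gx≡0 (sumMap-zero gxs≡0)) (ℚP.+-identityˡ 0ℚ)

sumMap-+ : ∀ (g h : A → ℚ) xs → sumMap (λ x → g x + h x) xs ≡ sumMap g xs + sumMap h xs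
sumMap-+ g h []       = refl
sumMap-+ g h (x ∷ xs) = trans (cong (_+_ (g x + h x)) (sumMap-+ g h xs))
  (interchange (g x) (h x) (sumMap g xs) (sumMap h xs))

sumMap-++ : ∀ (g : A → ℚ) xs ys → sumMap g (xs ++ ys) ≡ sumMap g xs + sumMap g ys
sumMap-++ g []       ys = sym (ℚP.+-identityˡ (sumMap g ys))
sumMap-++ g (x ∷ xs) ys = trans (cong (g x +_) (sumMap-++ g xs ys)) (sym (ℚP.+-assoc (g x) _ _))

sumMap-map : ∀ (g : B → ℚ) (f : A → B) xs → sumMap g (map f xs) ≡ sumMap (λ x → g (f x)) xs
sumMap-map g f []       = refl
sumMap-map g f (x ∷ xs) = cong (g (f x) +_) (sumMap-map g f xs)

sumMap-concatMap : ∀ (g : B → ℚ) (f : A → List B) xs →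
                   sumMap g (concatMap f xs) ≡ sumMap (λ x → sumMap g (f x)) xs
sumMap-concatMap g f []       = refl
sumMap-concatMap g f (x ∷ xs) =
  trans (sumMap-++ g (f x) _) (cong (sumMap g (f x) +_) (sumMap-concatMap g f xs))

sumMap-filter : ∀ {P : A → Set} (P? : Decidable P) (g : A → ℚ) xs →
                sumMap g (filter P? xs) ≡ sumMap (λ x → if does (P? x) then g x else 0ℚ) xs
sumMap-filter P? g []       = refl
sumMap-filter P? g (x ∷ xs) with does (P? x)
... | true  = cong (g x +_) (sumMap-filter P? g xs)
... | false = trans (sumMap-filter P? g xs) (sym (ℚP.+-identityˡ _))

sumMap-applyUpTo-point : ∀ (g : ℕ → ℚ) f n {a} → a < n → (∀ x → x ≢ a → g (f x) ≡ 0ℚ) →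
                         sumMap g (applyUpTo f n) ≡ g (f a)
sumMap-applyUpTo-point g f (suc n) {zero} _ vanish =
  trans (cong (g (f 0) +_) (sumMap-zero (applyUpTo⁺₂ (λ x → f (suc x)) n (λ x → vanish (suc x) λ ()))))
        (ℚP.+-identityʳ (g (f 0)))
sumMap-applyUpTo-point g f (suc n) {suc a} (s≤s a<n) vanish =
  trans (cong₂ _+_ (vanish 0 λ ())
                   (sumMap-applyUpTo-point g (λ x → f (suc x)) n a<n
                      λ x x≢a → vanish (suc x) (λ x+1≡a+1 → x≢a (ℕP.suc-injective x+1≡a+1))))
        (ℚP.+-identityˡ (g (f (suc a))))

sumMap-allTuples-point : ∀ n b (g : List ℕ → ℚ) {a} → length a ≡ n → All (_≤ b) a →
                         (∀ l → length l ≡ n → l ≢ a → g l ≡ 0ℚ) →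
                         sumMap g (allTuples n b) ≡ g a
sumMap-allTuples-point zero    b g {[]} refl [] vanish = ℚP.+-identityʳ (g [])
sumMap-allTuples-point (suc n) b g {x ∷ a} |a|≡1+n (x≤b ∷ a≤b) vanish = begin
  sumMap g (concatMap (λ y → map (y ∷_) (allTuples n b)) (upTo (suc b)))
    ≡⟨ sumMap-concatMap g (λ y → map (y ∷_) (allTuples n b)) (upTo (suc b)) ⟩
  sumMap (λ y → sumMap g (map (y ∷_) (allTuples n b))) (upTo (suc b))
    ≡⟨ sumMap-cong (λ y → trans (sumMap-map g (y ∷_) (allTuples n b)) (inner y)) (upTo (suc b)) ⟩
  sumMap (λ y → g (y ∷ a)) (upTo (suc b))
    ≡⟨ sumMap-applyUpTo-point (λ y → g (y ∷ a)) (λ y → y) (suc b) (s≤s x≤b)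
         (λ y y≢x → vanish (y ∷ a) |a|≡1+n (λ y∷a≡x∷a → y≢x (ListP.∷-injectiveˡ y∷a≡x∷a))) ⟩
  g (x ∷ a) ∎
  where
  open ≡-Reasoning
  inner : ∀ y → sumMap (λ t → g (y ∷ t)) (allTuples n b) ≡ g (y ∷ a)
  inner y = sumMap-allTuples-point n b (λ t → g (y ∷ t)) (ℕP.suc-injective |a|≡1+n) a≤b
    (λ t |t|≡n t≢a → vanish (y ∷ t) (cong suc |t|≡n) (λ y∷t≡y∷a → t≢a (ListP.∷-injectiveʳ y∷t≡y∷a)))

if-split : ∀ c (q : ℚ) → q ≡ (if c then q else 0ℚ) + (if c then 0ℚ else q)
if-split true  q = sym (ℚP.+-identityʳ q)
if-split false q = sym (ℚP.+-identityˡ q)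

sumMap-allTuples-two : ∀ n b (g : List ℕ → ℚ) {a a′} → a ≢ a′ →
                       length a ≡ n → All (_≤ b) a → length a′ ≡ n → All (_≤ b) a′ →
                       (∀ l → length l ≡ n → l ≢ a → l ≢ a′ → g l ≡ 0ℚ) →
                       sumMap g (allTuples n b) ≡ g a + g a′
sumMap-allTuples-two n b g {a} {a′} a≢a′ |a| a≤b |a′| a′≤b vanish = begin
  sumMap g (allTuples n b)
    ≡⟨ sumMap-cong (λ l → if-split (is-a l) (g l)) (allTuples n b) ⟩
  sumMap (λ l → at-a l + off-a l) (allTuples n b)
    ≡⟨ sumMap-+ at-a off-a (allTuples n b) ⟩
  sumMap at-a (allTuples n b) + sumMap off-a (allTuples n b)
    ≡⟨ cong₂ _+_ (sumMap-allTuples-point n b at-a |a| a≤b at-a-vanish)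
                 (sumMap-allTuples-point n b off-a |a′| a′≤b off-a-vanish) ⟩
  at-a a + off-a a′
    ≡⟨ cong₂ _+_ (cong (λ c → if c then g a else 0ℚ) (dec-true (a ≟ a) refl))
                 (cong (λ c → if c then 0ℚ else g a′) (dec-false (a′ ≟ a) (λ a′≡a → a≢a′ (sym a′≡a)))) ⟩
  g a + g a′ ∎
  where
  open ≡-Reasoning
  _≟_ : DecidableEquality (List ℕ)
  _≟_ = ListP.≡-dec ℕP._≟_
  is-a : List ℕ → Bool
  is-a l = does (l ≟ a)
  at-a off-a : List ℕ → ℚ
  at-a  l = if is-a l then g l else 0ℚ
  off-a l = if is-a l then 0ℚ else g l
  at-a-vanish : ∀ l → length l ≡ n → l ≢ a → at-a l ≡ 0ℚ
  at-a-vanish l _ l≢a = cong (λ c → if c then g l else 0ℚ) (dec-false (l ≟ a) l≢a)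
  off-a-vanish : ∀ l → length l ≡ n → l ≢ a′ → off-a l ≡ 0ℚ
  off-a-vanish l |l| l≢a′ with l ≟ a
  ... | yes _  = refl
  ... | no l≢a = vanish l |l| l≢a l≢a′

-- Coefficients of polynomials in ρ

coeff-addP : ∀ p q i → coeff (addP p q) i ≡ coeff p i + coeff q i
coeff-addP []      q       i       = sym (ℚP.+-identityˡ (coeff q i))
coeff-addP (a ∷ p) []      i       = sym (ℚP.+-identityʳ (coeff (a ∷ p) i))
coeff-addP (a ∷ p) (b ∷ q) zero    = refl
coeff-addP (a ∷ p) (b ∷ q) (suc i) = coeff-addP p q i

coeff-scaleP : ∀ c p i → coeff (scaleP c p) i ≡ c * coeff p i
coeff-scaleP c []      i       = sym (ℚP.*-zeroʳ c)
coeff-scaleP c (a ∷ p) zero    = refl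
coeff-scaleP c (a ∷ p) (suc i) = coeff-scaleP c p i

coeff-foldr-addP : ∀ (F : A → Poly) xs i →
                   coeff (foldr addP [] (map F xs)) i ≡ sumMap (λ x → coeff (F x) i) xs
coeff-foldr-addP F []       i = refl
coeff-foldr-addP F (x ∷ xs) i =
  trans (coeff-addP (F x) _ i) (cong (_+_ (coeff (F x) i)) (coeff-foldr-addP F xs i))

coeff-mulLin-suc : ∀ c p i → coeff (mulLin c p) (suc i) ≡ coeff p i + c * coeff p (suc i)
coeff-mulLin-suc c p i =
  trans (coeff-addP (0ℚ ∷ p) (scaleP c p) (suc i)) (cong (_+_ (coeff p i)) (coeff-scaleP c p (suc i)))

coeff-poch-> : ∀ N i → N < i → coeff (poch N) i ≡ 0ℚ
coeff-poch-> zero    (suc i) _         = refl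
coeff-poch-> (suc N) (suc i) (s≤s N<i) = begin
  coeff (poch (suc N)) (suc i)                     ≡⟨ coeff-mulLin-suc n (poch N) i ⟩
  coeff (poch N) i + n * coeff (poch N) (suc i)    ≡⟨ cong₂ (λ x y → x + n * y) (coeff-poch-> N i N<i)
                                                            (coeff-poch-> N (suc i) (ℕP.m<n⇒m<1+n N<i)) ⟩
  0ℚ + n * 0ℚ                                      ≡⟨ trans (ℚP.+-identityˡ (n * 0ℚ)) (ℚP.*-zeroʳ n) ⟩
  0ℚ                                               ∎
  where
  open ≡-Reasoning
  n = ℤ.+ N / 1

coeff-poch-leading : ∀ N → coeff (poch N) N ≡ 1ℚ
coeff-poch-leading zero    = refl
coeff-poch-leading (suc N) = begin
  coeff (poch (suc N)) (suc N)                     ≡⟨ coeff-mulLin-suc n (poch N) N ⟩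
  coeff (poch N) N + n * coeff (poch N) (suc N)    ≡⟨ cong₂ (λ x y → x + n * y) (coeff-poch-leading N)
                                                            (coeff-poch-> N (suc N) ℕP.≤-refl) ⟩
  1ℚ + n * 0ℚ                                      ≡⟨ trans (cong (_+_ 1ℚ) (ℚP.*-zeroʳ n)) (ℚP.+-identityʳ 1ℚ) ⟩
  1ℚ                                               ∎
  where
  open ≡-Reasoning
  n = ℤ.+ N / 1

coeff-poch-subleading : ∀ N → coeff (poch (suc N)) N ≡ ℤ.+ (N ℕ.* suc N) / 2
coeff-poch-subleading zero    = refl
coeff-poch-subleading (suc N) = begin
  coeff (poch (2 ℕ.+ N)) (suc N)
    ≡⟨ coeff-mulLin-suc n (poch (suc N)) N ⟩
  coeff (poch (suc N)) N + n * coeff (poch (suc N)) (suc N)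
    ≡⟨ cong₂ (λ x y → x + n * y) (coeff-poch-subleading N) (coeff-poch-leading (suc N)) ⟩
  ℤ.+ (N ℕ.* suc N) / 2 + n * 1ℚ
    ≡⟨ cong (_+_ (ℤ.+ (N ℕ.* suc N) / 2)) (ℚP.*-identityʳ n) ⟩
  ℤ.+ (N ℕ.* suc N) / 2 + n
    ≡⟨ /-+-/ (N ℕ.* suc N) 2 (suc N) 1 ⟩
  ℤ.+ (N ℕ.* suc N ℕ.* 1 ℕ.+ suc N ℕ.* 2) / (2 ℕ.* 1)
    ≡⟨ /-cross (N ℕ.* suc N ℕ.* 1 ℕ.+ suc N ℕ.* 2) (2 ℕ.* 1) (suc N ℕ.* (2 ℕ.+ N)) 2 (gauss N) ⟩
  ℤ.+ (suc N ℕ.* (2 ℕ.+ N)) / 2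
    ∎
  where
  open ≡-Reasoning
  n = ℤ.+ suc N / 1
  gauss : ∀ N → (N ℕ.* suc N ℕ.* 1 ℕ.+ suc N ℕ.* 2) ℕ.* 2 ≡ suc N ℕ.* (2 ℕ.+ N) ℕ.* (2 ℕ.* 1)
  gauss = solve-∀

-- Tuples (λ₁, …, λ_k)

sum-replicate-0 : ∀ n → sum (replicate n 0) ≡ 0
sum-replicate-0 zero    = refl
sum-replicate-0 (suc n) = sum-replicate-0 n

weightFrom-replicate-0 : ∀ i n → weightFrom i (replicate n 0) ≡ 0
weightFrom-replicate-0 i zero    = refl
weightFrom-replicate-0 i (suc n) = cong₂ ℕ._+_ (ℕP.*-zeroʳ i) (weightFrom-replicate-0 (suc i) n)

prodFactorFrom-replicate-0 : ∀ i n → prodFactorFrom i (replicate n 0) ≡ 1ℚ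
prodFactorFrom-replicate-0 i zero    = refl
prodFactorFrom-replicate-0 i (suc n) = cong (_*_ (factor i 0)) (prodFactorFrom-replicate-0 (suc i) n)

sum≡0⇒replicate-0 : ∀ r → sum r ≡ 0 → r ≡ replicate (length r) 0
sum≡0⇒replicate-0 []      _    = refl
sum≡0⇒replicate-0 (x ∷ r) Σ≡0 =
  cong₂ _∷_ (ℕP.m+n≡0⇒m≡0 x Σ≡0) (sum≡0⇒replicate-0 r (ℕP.m+n≡0⇒n≡0 x Σ≡0))

*-sum≤weightFrom : ∀ i r → i ℕ.* sum r ≤ weightFrom i r
*-sum≤weightFrom i []      = ℕP.≤-reflexive (ℕP.*-zeroʳ i)
*-sum≤weightFrom i (l ∷ r) = begin
  i ℕ.* (l ℕ.+ sum r)              ≡⟨ ℕP.*-distribˡ-+ i l (sum r) ⟩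
  i ℕ.* l ℕ.+ i ℕ.* sum r          ≤⟨ ℕP.+-monoʳ-≤ (i ℕ.* l) (ℕP.≤-trans (ℕP.*-monoˡ-≤ (sum r) (ℕP.n≤1+n i))
                                                                        (*-sum≤weightFrom (suc i) r)) ⟩
  i ℕ.* l ℕ.+ weightFrom (suc i) r ∎
  where open ℕP.≤-Reasoning

onesTuple onesTwoTuple : ℕ → List ℕ
onesTuple    m = 2 ℕ.+ m ∷ replicate (suc m) 0
onesTwoTuple m = m ∷ 1 ∷ replicate m 0

length-onesTuple : ∀ m → length (onesTuple m) ≡ 2 ℕ.+ m
length-onesTuple m = cong suc (ListP.length-replicate (suc m))

length-onesTwoTuple : ∀ m → length (onesTwoTuple m) ≡ 2 ℕ.+ m
length-onesTwoTuple m = cong (2 ℕ.+_) (ListP.length-replicate m)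

onesTuple-≤ : ∀ m → All (_≤ 2 ℕ.+ m) (onesTuple m)
onesTuple-≤ m = ℕP.≤-refl ∷ replicate⁺ (suc m) z≤n

onesTwoTuple-≤ : ∀ m → All (_≤ 2 ℕ.+ m) (onesTwoTuple m)
onesTwoTuple-≤ m = ℕP.m≤n+m m 2 ∷ s≤s z≤n ∷ replicate⁺ m z≤n

weight-onesTuple : ∀ m → weight (onesTuple m) ≡ 2 ℕ.+ m
weight-onesTuple m =
  trans (cong₂ ℕ._+_ (ℕP.*-identityˡ (2 ℕ.+ m)) (weightFrom-replicate-0 2 (suc m))) (ℕP.+-identityʳ (2 ℕ.+ m))

weight-onesTwoTuple : ∀ m → weight (onesTwoTuple m) ≡ 2 ℕ.+ m
weight-onesTwoTuple m =
  trans (cong₂ ℕ._+_ (ℕP.*-identityˡ m) (cong (2 ℕ.+_) (weightFrom-replicate-0 3 m))) (ℕP.+-comm m 2)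

onesTuple≢onesTwoTuple : ∀ m → onesTuple m ≢ onesTwoTuple m
onesTuple≢onesTwoTuple m ones≡onesTwo =
  ℕP.<⇒≢ (ℕP.m<n+m m (s≤s z≤n)) (sym (ListP.∷-injectiveˡ ones≡onesTwo))

excess≤1 : ∀ m x y s w → 3 ℕ.* s ≤ w → 1 ℕ.* x ℕ.+ (2 ℕ.* y ℕ.+ w) ≡ 2 ℕ.+ m →
           suc m ≤ x ℕ.+ (y ℕ.+ s) → y ℕ.+ 2 ℕ.* s ≤ 1
excess≤1 m x y s w 3s≤w weight≡ suc-m≤total = ℕP.+-cancelˡ-≤ (suc m) _ _ (begin
  suc m ℕ.+ (y ℕ.+ 2 ℕ.* s)                 ≤⟨ ℕP.+-monoˡ-≤ (y ℕ.+ 2 ℕ.* s) suc-m≤total ⟩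
  x ℕ.+ (y ℕ.+ s) ℕ.+ (y ℕ.+ 2 ℕ.* s)       ≡⟨ regroup x y s ⟩
  1 ℕ.* x ℕ.+ (2 ℕ.* y ℕ.+ 3 ℕ.* s)         ≤⟨ ℕP.+-monoʳ-≤ (1 ℕ.* x) (ℕP.+-monoʳ-≤ (2 ℕ.* y) 3s≤w) ⟩
  1 ℕ.* x ℕ.+ (2 ℕ.* y ℕ.+ w)               ≡⟨ weight≡ ⟩
  2 ℕ.+ m                                   ≡⟨ cong suc (ℕP.+-comm 1 m) ⟩
  suc m ℕ.+ 1                               ∎)
  where
  open ℕP.≤-Reasoning
  regroup : ∀ x y s → x ℕ.+ (y ℕ.+ s) ℕ.+ (y ℕ.+ 2 ℕ.* s) ≡ 1 ℕ.* x ℕ.+ (2 ℕ.* y ℕ.+ 3 ℕ.* s)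
  regroup = solve-∀

y+2s≤1 : ∀ y s → y ℕ.+ 2 ℕ.* s ≤ 1 → s ≡ 0 × (y ≡ 0 ⊎ y ≡ 1)
y+2s≤1 0             0       _ = refl , inj₁ refl
y+2s≤1 1             0       _ = refl , inj₂ refl
y+2s≤1 (suc (suc y)) 0       (s≤s ())
y+2s≤1 y             (suc s) y+2s≤1
  with s≤s 1≤ ← ℕP.m+n≤o⇒n≤o y y+2s≤1 with () ← ℕP.m+n≤o⇒n≤o s 1≤

onesTuple-or-onesTwoTuple : ∀ m x y → x ℕ.+ 2 ℕ.* y ≡ 2 ℕ.+ m → y ≡ 0 ⊎ y ≡ 1 →
                            x ∷ y ∷ replicate m 0 ≡ onesTuple m ⊎ x ∷ y ∷ replicate m 0 ≡ onesTwoTuple m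
onesTuple-or-onesTwoTuple m x y x+2y≡ (inj₁ refl) =
  inj₁ (cong (_∷ _) (trans (sym (ℕP.+-identityʳ x)) x+2y≡))
onesTuple-or-onesTwoTuple m x y x+2y≡ (inj₂ refl) =
  inj₂ (cong (_∷ _) (ℕP.+-cancelʳ-≡ 2 x m (trans x+2y≡ (ℕP.+-comm 2 m))))

large-total⇒onesTuple-or-onesTwoTuple : ∀ m l → length l ≡ 2 ℕ.+ m → weight l ≡ 2 ℕ.+ m →
                                        suc m ≤ total l → l ≡ onesTuple m ⊎ l ≡ onesTwoTuple m
large-total⇒onesTuple-or-onesTwoTuple m (x ∷ y ∷ r) |l| weight≡ suc-m≤total
  with s≡0 , y≡0∨1 ← y+2s≤1 y (sum r)
         (excess≤1 m x y (sum r) (weightFrom 3 r) (*-sum≤weightFrom 3 r) weight≡ suc-m≤total)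
  with refl ← trans (sum≡0⇒replicate-0 r s≡0)
                    (cong (λ n → replicate n 0) (ℕP.suc-injective (ℕP.suc-injective |l|)))
  = onesTuple-or-onesTwoTuple m x y x+2y≡ y≡0∨1
  where
  x+2y≡ : x ℕ.+ 2 ℕ.* y ≡ 2 ℕ.+ m
  x+2y≡ = begin
    x ℕ.+ 2 ℕ.* y
      ≡⟨ regroup x y ⟩
    1 ℕ.* x ℕ.+ (2 ℕ.* y ℕ.+ 0)
      ≡⟨ cong (λ w → 1 ℕ.* x ℕ.+ (2 ℕ.* y ℕ.+ w)) (weightFrom-replicate-0 3 m) ⟨
    1 ℕ.* x ℕ.+ (2 ℕ.* y ℕ.+ weightFrom 3 (replicate m 0))
      ≡⟨ weight≡ ⟩
    2 ℕ.+ m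
      ∎
    where
    open ≡-Reasoning
    regroup : ∀ x y → x ℕ.+ 2 ℕ.* y ≡ 1 ℕ.* x ℕ.+ (2 ℕ.* y ℕ.+ 0)
    regroup = solve-∀

-- The coefficient of ρ^i in c_{ρ,k}

sgn-+-even : ∀ m n → sgn (m ℕ.+ (n ℕ.+ n)) ≡ sgn m
sgn-+-even m zero    = cong sgn (ℕP.+-identityʳ m)
sgn-+-even m (suc n) = begin
  sgn (m ℕ.+ (suc n ℕ.+ suc n))     ≡⟨ cong sgn (shift m n) ⟩
  - - sgn (m ℕ.+ (n ℕ.+ n))         ≡⟨ ⁻¹-involutive (sgn (m ℕ.+ (n ℕ.+ n))) ⟩
  sgn (m ℕ.+ (n ℕ.+ n))             ≡⟨ sgn-+-even m n ⟩
  sgn m                             ∎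
  where
  open ≡-Reasoning
  shift : ∀ m n → m ℕ.+ (suc n ℕ.+ suc n) ≡ 2 ℕ.+ (m ℕ.+ (n ℕ.+ n))
  shift = solve-∀

contribution : ℕ → ℕ → List ℕ → ℚ
contribution k i l = (sgn (k ℕ.+ total l) * prodFactor l) * coeff (poch (total l)) i

weightedContribution : ℕ → ℕ → List ℕ → ℚ
weightedContribution k i l = if does (weight l ℕ.≟ k) then contribution k i l else 0ℚ

C-as-sum : ∀ k i → C k i ≡ sumMap (weightedContribution k i) (allTuples k k)
C-as-sum k i = begin
  coeff (foldr addP [] (map term (partitionTuples k))) i
    ≡⟨ coeff-foldr-addP term (partitionTuples k) i ⟩
  sumMap (λ l → coeff (term l) i) (partitionTuples k)
    ≡⟨ sumMap-cong (λ l → coeff-scaleP (sgn (k ℕ.+ total l) * prodFactor l) (poch (total l)) i) (partitionTuples k) ⟩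
  sumMap (contribution k i) (partitionTuples k)
    ≡⟨ sumMap-filter (λ l → weight l ℕ.≟ k) (contribution k i) (allTuples k k) ⟩
  sumMap (weightedContribution k i) (allTuples k k) ∎
  where
  open ≡-Reasoning
  term : List ℕ → Poly
  term l = scaleP (sgn (k ℕ.+ total l) * prodFactor l) (poch (total l))

contribution-total : ∀ k i l {N} → total l ≡ N →
                     contribution k i l ≡ (sgn (k ℕ.+ N) * prodFactor l) * coeff (poch N) i
contribution-total k i l refl = refl

contribution-small-total : ∀ k i l → total l < i → contribution k i l ≡ 0ℚ
contribution-small-total k i l total<i =
  trans (cong (_*_ (sgn (k ℕ.+ total l) * prodFactor l)) (coeff-poch-> (total l) i total<i))
        (ℚP.*-zeroʳ (sgn (k ℕ.+ total l) * prodFactor l))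

contribution-onesTuple : ∀ m → contribution (2 ℕ.+ m) (suc m) (onesTuple m)
                               ≡ factor 1 (2 ℕ.+ m) * (ℤ.+ (suc m ℕ.* (2 ℕ.+ m)) / 2)
contribution-onesTuple m = begin
  contribution k (suc m) (onesTuple m)
    ≡⟨ contribution-total k (suc m) (onesTuple m) total≡ ⟩
  (sgn (k ℕ.+ k) * (factor 1 k * prodFactorFrom 2 (replicate (suc m) 0))) * coeff (poch k) (suc m)
    ≡⟨ cong₂ (λ s p → (s * (factor 1 k * p)) * coeff (poch k) (suc m))
             (sgn-+-even 0 k) (prodFactorFrom-replicate-0 2 (suc m)) ⟩
  (1ℚ * (factor 1 k * 1ℚ)) * coeff (poch k) (suc m)
    ≡⟨ cong₂ _*_ (trans (ℚP.*-identityˡ _) (ℚP.*-identityʳ (factor 1 k))) (coeff-poch-subleading (suc m)) ⟩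
  factor 1 k * (ℤ.+ (suc m ℕ.* k) / 2) ∎
  where
  open ≡-Reasoning
  k : ℕ
  k = 2 ℕ.+ m
  total≡ : total (onesTuple m) ≡ k
  total≡ = trans (cong (k ℕ.+_) (sum-replicate-0 (suc m))) (ℕP.+-identityʳ k)

contribution-onesTwoTuple : ∀ m → contribution (2 ℕ.+ m) (suc m) (onesTwoTuple m)
                                  ≡ - (factor 1 m * factor 2 1)
contribution-onesTwoTuple m = begin
  contribution k (suc m) (onesTwoTuple m)
    ≡⟨ contribution-total k (suc m) (onesTwoTuple m) total≡ ⟩
  (sgn (1 ℕ.+ (suc m ℕ.+ suc m)) * (factor 1 m * (factor 2 1 * prodFactorFrom 3 (replicate m 0))))
    * coeff (poch (suc m)) (suc m)
    ≡⟨ cong₂ (λ s p → (s * (factor 1 m * (factor 2 1 * p))) * coeff (poch (suc m)) (suc m))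
             (sgn-+-even 1 (suc m)) (prodFactorFrom-replicate-0 3 m) ⟩
  (- 1ℚ * (factor 1 m * (factor 2 1 * 1ℚ))) * coeff (poch (suc m)) (suc m)
    ≡⟨ cong₂ (λ p c → (- 1ℚ * (factor 1 m * p)) * c) (ℚP.*-identityʳ (factor 2 1)) (coeff-poch-leading (suc m)) ⟩
  (- 1ℚ * (factor 1 m * factor 2 1)) * 1ℚ
    ≡⟨ ℚP.*-identityʳ _ ⟩
  - 1ℚ * (factor 1 m * factor 2 1)
    ≡⟨ ℚP.neg-distribˡ-* 1ℚ (factor 1 m * factor 2 1) ⟨
  - (1ℚ * (factor 1 m * factor 2 1))
    ≡⟨ cong -_ (ℚP.*-identityˡ (factor 1 m * factor 2 1)) ⟩
  - (factor 1 m * factor 2 1) ∎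
  where
  open ≡-Reasoning
  k : ℕ
  k = 2 ℕ.+ m
  total≡ : total (onesTwoTuple m) ≡ suc m
  total≡ = trans (cong (λ s → m ℕ.+ suc s) (sum-replicate-0 m)) (ℕP.+-comm m 1)

weightedContribution-weight : ∀ k i l → weight l ≡ k → weightedContribution k i l ≡ contribution k i l
weightedContribution-weight k i l weight≡ =
  cong (λ c → if c then contribution k i l else 0ℚ) (dec-true (weight l ℕ.≟ k) weight≡)

weightedContribution-weight≢ : ∀ k i l → weight l ≢ k → weightedContribution k i l ≡ 0ℚ
weightedContribution-weight≢ k i l weight≢ =
  cong (λ c → if c then contribution k i l else 0ℚ) (dec-false (weight l ℕ.≟ k) weight≢)

weightedContribution-vanishes : ∀ m l → length l ≡ 2 ℕ.+ m → l ≢ onesTuple m → l ≢ onesTwoTuple m →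
                                weightedContribution (2 ℕ.+ m) (suc m) l ≡ 0ℚ
weightedContribution-vanishes m l |l| l≢ones l≢onesTwo with weight l ℕ.≟ 2 ℕ.+ m
... | no weight≢  = weightedContribution-weight≢ (2 ℕ.+ m) (suc m) l weight≢
... | yes weight≡ with suc m ℕ.≤? total l
...   | yes large = ⊥-elim ([ l≢ones , l≢onesTwo ] (large-total⇒onesTuple-or-onesTwoTuple m l |l| weight≡ large))
...   | no small  = trans (weightedContribution-weight (2 ℕ.+ m) (suc m) l weight≡)
                          (contribution-small-total (2 ℕ.+ m) (suc m) l (ℕP.≰⇒> small))

-- (3!)^k, k! and denom k for k = 2 + m unfolded, with P = 6^m and F = m! abstracted
-- so that the ring solver applies
cosec-cross-multiplied : ∀ m P F →
  1 ℕ.* (suc m ℕ.* (2 ℕ.+ m)) ℕ.* (5 ℕ.* (6 ℕ.* (6 ℕ.* P)) ℕ.* F ℕ.* (P ℕ.* F ℕ.* 120))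
  ≡ (1 ℕ.* (P ℕ.* F ℕ.* 120) ℕ.+ 1 ℕ.* 1 ℕ.* (5 ℕ.* (6 ℕ.* (6 ℕ.* P)) ℕ.* F))
    ℕ.* (6 ℕ.* (6 ℕ.* P) ℕ.* ((2 ℕ.+ m) ℕ.* (suc m ℕ.* F)) ℕ.* 2)
cosec-cross-multiplied = solve-∀

cosec-arithmetic : ∀ m → factor 1 (2 ℕ.+ m) * (ℤ.+ (suc m ℕ.* (2 ℕ.+ m)) / 2) + - (factor 1 m * factor 2 1)
                         ≡ target (2 ℕ.+ m)
cosec-arithmetic m = begin
  a + - b             ≡⟨ cong (λ x → x + - b) a≡target+b ⟩
  target k + b + - b  ≡⟨ //-rightDividesʳ b (target k) ⟩
  target k            ∎
  where
  open ≡-Reasoning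
  k P F Dk Db : ℕ
  k  = 2 ℕ.+ m
  P  = (3 !) ℕ.^ m
  F  = m !
  Dk = (3 !) ℕ.^ k ℕ.* k !
  Db = P ℕ.* F ℕ.* 120
  a b : ℚ
  a = factor 1 k * (ℤ.+ (suc m ℕ.* k) / 2)
  b = factor 1 m * factor 2 1
  instance
    nz-P*F : NonZero (P ℕ.* F)
    nz-P*F = ℕP.m*n≢0 _ _ {{ℕP.m^n≢0 6 m}} {{m ℕP.!≢0}}
    nz-Dk : NonZero Dk
    nz-Dk = ℕP.m*n≢0 _ _ {{ℕP.m^n≢0 6 k}} {{k ℕP.!≢0}}
    nz-Dk*2 : NonZero (Dk ℕ.* 2)
    nz-Dk*2 = ℕP.m*n≢0 Dk 2
    nz-Db : NonZero Db
    nz-Db = ℕP.m*n≢0 (P ℕ.* F) 120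
    nz-denom : NonZero (denom k)
    nz-denom = ℕP.m*n≢0 _ _ {{ℕP.m*n≢0 5 _ {{_}} {{ℕP.m^n≢0 6 k}}}} {{m ℕP.!≢0}}
    nz-denom*Db : NonZero (denom k ℕ.* Db)
    nz-denom*Db = ℕP.m*n≢0 (denom k) Db
  a≡target+b : a ≡ target k + b
  a≡target+b = begin
    a
      ≡⟨ /-*-/ 1 Dk (suc m ℕ.* k) 2 ⟩
    ℤ.+ (1 ℕ.* (suc m ℕ.* k)) / (Dk ℕ.* 2)
      ≡⟨ /-cross (1 ℕ.* (suc m ℕ.* k)) (Dk ℕ.* 2) (1 ℕ.* Db ℕ.+ 1 ℕ.* 1 ℕ.* denom k) (denom k ℕ.* Db)
                 (cosec-cross-multiplied m P F) ⟩
    ℤ.+ (1 ℕ.* Db ℕ.+ 1 ℕ.* 1 ℕ.* denom k) / (denom k ℕ.* Db)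
      ≡⟨ /-+-/ 1 (denom k) (1 ℕ.* 1) Db ⟨
    target k + ℤ.+ (1 ℕ.* 1) / Db
      ≡⟨ cong (_+_ (target k)) (/-*-/ 1 (P ℕ.* F) 1 120) ⟨
    target k + b
      ∎

mainTheorem2 : (k : ℕ) → 2 ≤ k → C k (k ∸ 1) ≡ target k
mainTheorem2 1 (s≤s ())
mainTheorem2 k@(suc (suc m)) _ = begin
  C k (suc m)
    ≡⟨ C-as-sum k (suc m) ⟩
  sumMap (weightedContribution k (suc m)) (allTuples k k)
    ≡⟨ sumMap-allTuples-two k k (weightedContribution k (suc m)) (onesTuple≢onesTwoTuple m)
         (length-onesTuple m) (onesTuple-≤ m) (length-onesTwoTuple m) (onesTwoTuple-≤ m)
         (weightedContribution-vanishes m) ⟩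
  weightedContribution k (suc m) (onesTuple m) + weightedContribution k (suc m) (onesTwoTuple m)
    ≡⟨ cong₂ _+_ (weightedContribution-weight k (suc m) (onesTuple m) (weight-onesTuple m))
                 (weightedContribution-weight k (suc m) (onesTwoTuple m) (weight-onesTwoTuple m)) ⟩
  contribution k (suc m) (onesTuple m) + contribution k (suc m) (onesTwoTuple m)
    ≡⟨ cong₂ _+_ (contribution-onesTuple m) (contribution-onesTwoTuple m) ⟩
  factor 1 k * (ℤ.+ (suc m ℕ.* k) / 2) + - (factor 1 m * factor 2 1)
    ≡⟨ cosec-arithmetic m ⟩
  target k ∎
  where open ≡-Reasoning
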